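{- Let $G=(V,E)$ be a graph with $\mathrm{vi}(G)=k$. Let $G'$ be the graph obtained from $G$ by keeping all vertices and edges of $G$ and, for each edge $e=\{u,w\}\in E$, adding a new vertex $v_e$ adjacent to both $u$ and $w$. Then $\mathrm{vi}(G')\le k^2$.
   Context: The vertex integrity is $\mathrm{vi}(G)=\min_{S\subseteq V(G)}\bigl(|S|+\max_C|V(C)|\bigr)$, where $C$ ranges over the connected components of $G-S$. -}

module Defs where

open import Level using (0ℓ)
open import Data.Bool using (Bool; true; false; T)
open import Data.Nat using (ℕ; _+_; _*_; _≤_; _<_)
open import Data.Fin using (Fin)
import Data.Fin as Fin
open import Data.Product using (Σ; ∃; _×_; _,_; proj₁; proj₂)
open import Data.Sum using (_⊎_; inj₁; inj₂)
open import Data.Empty using (⊥)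
open import Data.List using (List; length)
open import Data.List.Membership.Propositional using (_∈_; _∉_)
open import Data.List.Relation.Unary.Unique.Propositional using (Unique)
open import Relation.Binary.PropositionalEquality using (_≡_; subst)
open import Relation.Nullary using (¬_)

record SimpleGraph (n : ℕ) : Set where
  field
    adj    : Fin n → Fin n → Bool
    sym    : ∀ i j → adj i j ≡ adj j i
    irrefl : ∀ i → adj i i ≡ false
open SimpleGraph public

record Graph : Set₁ where
  field
    Vtx   : Set
    _~_   : Vtx → Vtx → Set
    ~-sym : ∀ {u v} → u ~ v → v ~ u
    ~-irr : ∀ {v} → ¬ (v ~ v)
open Graph public

asGraph : ∀ {n} → SimpleGraph n → Graph
asGraph {n} G = record
  { Vtx   = Fin n
  ; _~_   = λ i j → T (adj G i j)
  ; ~-sym = λ {u} {v} p → subst T (SimpleGraph.sym G u v) p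
  ; ~-irr = λ {v} p → subst T (irrefl G v) p
  }

module _ (H : Graph) where
  private
    V = Vtx H
    _≈_ = _~_ H

  data Reach (S : List V) : V → V → Set where
    here : ∀ {u} → u ∉ S → Reach S u u
    step : ∀ {u w v} → u ∉ S → u ≈ w → Reach S w v → Reach S u v

  record IsComponent (S C : List V) : Set where
    field
      uniq      : Unique C
      nonempty  : ∃ λ v → v ∈ C
      avoids    : ∀ {v} → v ∈ C → v ∉ S
      connected : ∀ {u v} → u ∈ C → v ∈ C → Reach S u v
      closed    : ∀ {u v} → u ∈ C → v ∉ S → u ≈ v → v ∈ C

  CompBound : List V → ℕ → Set
  CompBound S m = ∀ C → IsComponent S C → length C ≤ m

  -- vi(H) ≡ k, i.e. k = min over S of (|S| + max_C |V(C)|), where S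
  -- ranges over duplicate-free lists of vertices (finite vertex sets)
  -- and max_C |V(C)| (taken as 0 when H - S is empty) is the least
  -- upper bound of the component orders; min over (S , m) with m an
  -- upper bound of |S| + m equals min over S of |S| + max.
  IsVI : ℕ → Set
  IsVI k =
    (Σ (List V) λ S → Σ ℕ λ m → Unique S × CompBound S m × length S + m ≡ k)
    × (∀ S m → Unique S → CompBound S m → k ≤ length S + m)

-- The graph G' : G together with, for each edge {i,j} (represented once,
-- as i < j), a new vertex adjacent to exactly i and j.
EdgeOf : ∀ {n} → SimpleGraph n → Set
EdgeOf {n} G = Σ (Fin n × Fin n) λ p → proj₁ p Fin.< proj₂ p × T (adj G (proj₁ p) (proj₂ p))

subdivAdj : ∀ {n} (G : SimpleGraph n) → Fin n ⊎ EdgeOf G → Fin n ⊎ EdgeOf G → Set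
subdivAdj G (inj₁ i) (inj₁ j) = T (adj G i j)
subdivAdj G (inj₁ u) (inj₂ ((i , j) , _)) = u ≡ i ⊎ u ≡ j
subdivAdj G (inj₂ ((i , j) , _)) (inj₁ u) = u ≡ i ⊎ u ≡ j
subdivAdj G (inj₂ _) (inj₂ _) = ⊥

private
  subdivAdj-sym : ∀ {n} (G : SimpleGraph n) {x y} → subdivAdj G x y → subdivAdj G y x
  subdivAdj-sym G {inj₁ i} {inj₁ j} p = subst T (SimpleGraph.sym G i j) p
  subdivAdj-sym G {inj₁ u} {inj₂ _} p = p
  subdivAdj-sym G {inj₂ _} {inj₁ u} p = p
  subdivAdj-sym G {inj₂ _} {inj₂ _} ()

  subdivAdj-irr : ∀ {n} (G : SimpleGraph n) {x} → ¬ subdivAdj G x x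
  subdivAdj-irr G {inj₁ i} p = subst T (irrefl G i) p
  subdivAdj-irr G {inj₂ _} ()

withTriangles : ∀ {n} → SimpleGraph n → Graph
withTriangles G = record
  { Vtx   = _
  ; _~_   = subdivAdj G
  ; ~-sym = λ {x} {y} → subdivAdj-sym G {x} {y}
  ; ~-irr = λ {x} → subdivAdj-irr G {x}
  }

module Submission where

-- Let S be an optimal separator of G: |S| = s, every component of G - S has
-- at most m vertices, and k = s + m.  Delete the same S from G'.  A component
-- of G' - S containing an old vertex u consists of the component C of u in
-- G - S and of triangle vertices v_e whose edge e has one end in C and the
-- other in C ∪ S; listing the end in C first encodes them injectively as pairs
-- in C × (C ∪ S), so the component has at most m (m + s) vertices.  Any other
-- component is a single v_e with both ends of e in S, possible only if s ≥ 2.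
-- Hence vi(G') ≤ s + m (m + s) + (s ∸ 1) ≤ (s + m)².
--
-- Components are built by filtering the vertices reachable from u, which needs
-- reachability in G - S to be decidable; as the conclusion is a decidable
-- inequality, the double negation of that decidability suffices.

open import Defs hiding (sym)
open import Data.Nat using (ℕ; zero; suc; _+_; _*_; _∸_; _≤_; z≤n; s≤s; _≤?_)
open import Data.Nat.Properties
  using (≤-trans; m≤m+n; m≤n+m; m≤m*n; *-mono-≤; +-monoˡ-≤; +-monoʳ-≤; ∸-monoˡ-≤; module ≤-Reasoning)
open import Data.Nat.Tactic.RingSolver using (solve-∀)
open import Data.Bool using (T)
open import Data.Bool.Properties using (T-irrelevant)
open import Data.Fin using (Fin)
import Data.Fin as Fin
import Data.Fin.Properties as Fin
open import Data.Product using (_×_; _,_; proj₂)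
open import Data.Sum using (_⊎_; inj₁; inj₂; [_,_]′)
import Data.Sum
open import Data.Empty using (⊥-elim)
open import Data.List using (List; []; _∷_; length; map; filter; _++_; cartesianProduct; allFin)
open import Data.List.Properties using (length-map; length-++; length-removeAt′)
open import Data.List.Membership.Propositional using (_∈_; _∉_)
open import Data.List.Membership.Propositional.Properties
  using (∈-filter⁺; ∈-filter⁻; ∈-map⁺; ∈-map⁻; ∈-++⁺ˡ; ∈-++⁺ʳ; ∈-cartesianProduct⁺; ∈-allFin)
open import Data.List.Relation.Binary.Subset.Propositional using (_⊆_)
open import Data.List.Relation.Unary.Any using (here; there; _─_)
import Data.List.Relation.Unary.All as All
open import Data.List.Relation.Unary.AllPairs using ([]; _∷_)
open import Data.List.Relation.Unary.Unique.Propositional using (Unique)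
import Data.List.Relation.Unary.Unique.Propositional.Properties as Unique
open import Relation.Binary.Definitions using (Decidable)
open import Relation.Binary.PropositionalEquality using (_≡_; _≢_; refl; sym; trans; cong; cong₂; subst)
open import Relation.Nullary using (¬_; yes; no)
open import Relation.Nullary.Decidable.Core using (¬¬-excluded-middle; decidable-stable)

module _ {A : Set} where

  ∈-─⁺ : ∀ {x z : A} {ys} (x∈ys : x ∈ ys) → z ∈ ys → z ≢ x → z ∈ (ys ─ x∈ys)
  ∈-─⁺ (here refl) (here refl) z≢x = ⊥-elim (z≢x refl)
  ∈-─⁺ (here refl) (there z∈ys) z≢x = z∈ys
  ∈-─⁺ (there x∈ys) (here refl) z≢x = here refl
  ∈-─⁺ (there x∈ys) (there z∈ys) z≢x = there (∈-─⁺ x∈ys z∈ys z≢x)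

  Unique-⊆⇒length≤ : ∀ {xs ys : List A} → Unique xs → xs ⊆ ys → length xs ≤ length ys
  Unique-⊆⇒length≤ {[]} _ _ = z≤n
  Unique-⊆⇒length≤ {x ∷ xs} {ys} (x∉xs ∷ uxs) xs⊆ys =
    subst (length (x ∷ xs) ≤_) (sym (length-removeAt′ ys _))
      (s≤s (Unique-⊆⇒length≤ uxs λ z∈xs →
        ∈-─⁺ x∈ys (xs⊆ys (there z∈xs)) (λ z≡x → All.lookup x∉xs z∈xs (sym z≡x))))
    where x∈ys = xs⊆ys (here refl)

  Unique-constant⇒length≤1 : ∀ {x : A} {xs} → Unique xs → (∀ {y} → y ∈ xs → y ≡ x) → length xs ≤ 1
  Unique-constant⇒length≤1 {x} uxs xs≡x =
    Unique-⊆⇒length≤ {ys = x ∷ []} uxs (λ y∈xs → here (xs≡x y∈xs))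

  distinct-∈⇒2≤length : ∀ {a b : A} {xs} → a ≢ b → a ∈ xs → b ∈ xs → 2 ≤ length xs
  distinct-∈⇒2≤length a≢b a∈xs b∈xs = Unique-⊆⇒length≤ ((a≢b All.∷ All.[]) ∷ All.[] ∷ [])
    λ { (here refl) → a∈xs ; (there (here refl)) → b∈xs }

  length-cartesianProduct : ∀ {B : Set} (xs : List A) (ys : List B) →
                            length (cartesianProduct xs ys) ≡ length xs * length ys
  length-cartesianProduct [] ys = refl
  length-cartesianProduct (x ∷ xs) ys =
    trans (length-++ (map (x ,_) ys)) (cong₂ _+_ (length-map _ ys) (length-cartesianProduct xs ys))

n+[n∸1]≤n*n : ∀ n → n + (n ∸ 1) ≤ n * n
n+[n∸1]≤n*n zero = z≤n
n+[n∸1]≤n*n (suc n) = s≤s (+-monoʳ-≤ n (m≤m*n n (suc n)))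

separator-bound : ∀ s m → s + (m * (m + s) + (s ∸ 1)) ≤ (s + m) * (s + m)
separator-bound s m = begin
  s + (m * (m + s) + (s ∸ 1))          ≡⟨ regroup s m (s ∸ 1) ⟩
  (s + (s ∸ 1)) + m * (m + s)          ≤⟨ +-monoˡ-≤ (m * (m + s)) (n+[n∸1]≤n*n s) ⟩
  s * s + m * (m + s)                  ≤⟨ m≤m+n (s * s + m * (m + s)) (s * m) ⟩
  s * s + m * (m + s) + s * m          ≡⟨ square s m ⟩
  (s + m) * (s + m)                    ∎
  where
  open ≤-Reasoning
  regroup : ∀ s m t → s + (m * (m + s) + t) ≡ (s + t) + m * (m + s)
  regroup = solve-∀
  square : ∀ s m → s * s + m * (m + s) + s * m ≡ (s + m) * (s + m)
  square = solve-∀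

orientation-unique : ∀ {n} {i j i′ j′ : Fin n} {p} → i Fin.< j → i′ Fin.< j′ →
                     p ≡ (i , j) ⊎ p ≡ (j , i) → p ≡ (i′ , j′) ⊎ p ≡ (j′ , i′) →
                     i ≡ i′ × j ≡ j′
orientation-unique _ _ (inj₁ refl) (inj₁ refl) = refl , refl
orientation-unique _ _ (inj₂ refl) (inj₂ refl) = refl , refl
orientation-unique i<j i′<j′ (inj₁ refl) (inj₂ refl) = ⊥-elim (Fin.<-asym i<j i′<j′)
orientation-unique i<j i′<j′ (inj₂ refl) (inj₁ refl) = ⊥-elim (Fin.<-asym i<j i′<j′)

¬¬-Π-Fin : ∀ {n} {P : Fin n → Set} → (∀ i → ¬ ¬ P i) → ¬ ¬ (∀ i → P i)
¬¬-Π-Fin {zero} ¬¬P ¬Π = ¬Π λ ()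
¬¬-Π-Fin {suc n} ¬¬P ¬Π = ¬¬P Fin.zero λ P₀ → ¬¬-Π-Fin (λ i → ¬¬P (Fin.suc i))
  λ Pₛ → ¬Π λ { Fin.zero → P₀ ; (Fin.suc i) → Pₛ i }

module _ (H : Graph) {S : List (Vtx H)} where

  Reach⇒source∉ : ∀ {u v} → Reach H S u v → u ∉ S
  Reach⇒source∉ (here u∉S) = u∉S
  Reach⇒source∉ (step u∉S _ _) = u∉S

  Reach⇒target∉ : ∀ {u v} → Reach H S u v → v ∉ S
  Reach⇒target∉ (here v∉S) = v∉S
  Reach⇒target∉ (step _ _ r) = Reach⇒target∉ r

  Reach-snoc : ∀ {u v w} → Reach H S u v → _~_ H v w → w ∉ S → Reach H S u w
  Reach-snoc (here u∉S) v~w w∉S = step u∉S v~w (here w∉S)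
  Reach-snoc (step u∉S u~x r) v~w w∉S = step u∉S u~x (Reach-snoc r v~w w∉S)

  Reach-sym : ∀ {u v} → Reach H S u v → Reach H S v u
  Reach-sym (here u∉S) = here u∉S
  Reach-sym (step u∉S u~x r) = Reach-snoc (Reach-sym r) (~-sym H u~x) u∉S

  Reach-trans : ∀ {u v w} → Reach H S u v → Reach H S v w → Reach H S u w
  Reach-trans (here _) r = r
  Reach-trans (step u∉S u~x r) r′ = step u∉S u~x (Reach-trans r r′)

module Components (H : Graph) (vertices : List (Vtx H)) (vertices-unique : Unique vertices)
                  (∈-vertices : ∀ v → v ∈ vertices)
                  (S : List (Vtx H)) (reach? : Decidable (Reach H S)) where

  component : Vtx H → List (Vtx H)
  component u = filter (reach? u) vertices

  ∈-component⁺ : ∀ {u v} → Reach H S u v → v ∈ component u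
  ∈-component⁺ {u} {v} r = ∈-filter⁺ (reach? u) (∈-vertices v) r

  ∈-component⁻ : ∀ {u v} → v ∈ component u → Reach H S u v
  ∈-component⁻ {u} v∈C = proj₂ (∈-filter⁻ (reach? u) {xs = vertices} v∈C)

  component-isComponent : ∀ {u} → u ∉ S → IsComponent H S (component u)
  component-isComponent {u} u∉S = record
    { uniq      = Unique.filter⁺ (reach? u) vertices-unique
    ; nonempty  = u , ∈-component⁺ (here u∉S)
    ; avoids    = λ v∈C → Reach⇒target∉ H (∈-component⁻ v∈C)
    ; connected = λ v∈C w∈C → Reach-trans H (Reach-sym H (∈-component⁻ v∈C)) (∈-component⁻ w∈C)
    ; closed    = λ v∈C w∉S v~w → ∈-component⁺ (Reach-snoc H (∈-component⁻ v∈C) v~w w∉S)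
    }

¬¬-Reach-decidable : ∀ {n} (G : SimpleGraph n) (S : List (Fin n)) → ¬ ¬ Decidable (Reach (asGraph G) S)
¬¬-Reach-decidable G S = ¬¬-Π-Fin λ u → ¬¬-Π-Fin λ v → ¬¬-excluded-middle

module WithTriangles {n : ℕ} (G : SimpleGraph n) (S : List (Fin n))
                     (reach? : Decidable (Reach (asGraph G) S)) where
  open import Data.List.Membership.DecPropositional (Fin._≟_ {n}) using (_∈?_)
  open Components (asGraph G) (allFin n) (Unique.allFin⁺ n) ∈-allFin S reach?

  private
    G⁺ = withTriangles G
    V⁺ = Fin n ⊎ EdgeOf G

  S⁺ : List V⁺
  S⁺ = map inj₁ S

  ∉S⇒∉S⁺ : ∀ {v} → v ∉ S → inj₁ v ∉ S⁺
  ∉S⇒∉S⁺ v∉S v∈S⁺ with ∈-map⁻ inj₁ v∈S⁺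
  ... | _ , v∈S , refl = v∉S v∈S

  ∉S⁺⇒∉S : ∀ {v} → inj₁ v ∉ S⁺ → v ∉ S
  ∉S⁺⇒∉S v∉S⁺ v∈S = v∉S⁺ (∈-map⁺ inj₁ v∈S)

  adj-sym : ∀ {i j} → T (adj G i j) → T (adj G j i)
  adj-sym {i} {j} = subst T (SimpleGraph.sym G i j)

  Touches : Fin n → V⁺ → Set
  Touches u (inj₁ v) = Reach (asGraph G) S u v
  Touches u (inj₂ ((i , j) , _)) = Reach (asGraph G) S u i ⊎ Reach (asGraph G) S u j

  Touches-step : ∀ {u} x y → Touches u x → subdivAdj G x y → y ∉ S⁺ → Touches u y
  Touches-step (inj₁ _) (inj₁ _) r v~w w∉ = Reach-snoc (asGraph G) r v~w (∉S⁺⇒∉S w∉)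
  Touches-step (inj₁ _) (inj₂ _) r (inj₁ refl) _ = inj₁ r
  Touches-step (inj₁ _) (inj₂ _) r (inj₂ refl) _ = inj₂ r
  Touches-step (inj₂ _) (inj₁ _) (inj₁ r) (inj₁ refl) _ = r
  Touches-step (inj₂ _) (inj₁ _) (inj₂ r) (inj₂ refl) _ = r
  Touches-step (inj₂ (_ , _ , a)) (inj₁ _) (inj₂ r) (inj₁ refl) w∉ =
    Reach-snoc (asGraph G) r (adj-sym a) (∉S⁺⇒∉S w∉)
  Touches-step (inj₂ (_ , _ , a)) (inj₁ _) (inj₁ r) (inj₂ refl) w∉ =
    Reach-snoc (asGraph G) r a (∉S⁺⇒∉S w∉)

  Reach⁺⇒Touches : ∀ {u x y} → Reach G⁺ S⁺ x y → Touches u x → Touches u y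
  Reach⁺⇒Touches (here _) t = t
  Reach⁺⇒Touches {x = x} (step {w = w} _ x~w r) t =
    Reach⁺⇒Touches r (Touches-step x w t x~w (Reach⇒source∉ G⁺ r))

  neighbour-∈-component-or-S : ∀ {u i j} → i ∈ component u → T (adj G i j) → j ∈ component u ++ S
  neighbour-∈-component-or-S {j = j} i∈C a with j ∈? S
  ... | yes j∈S = ∈-++⁺ʳ _ j∈S
  ... | no j∉S = ∈-++⁺ˡ (∈-component⁺ (Reach-snoc (asGraph G) (∈-component⁻ i∈C) a j∉S))

  orient : (C : List (Fin n)) → Fin n → Fin n → Fin n × Fin n
  orient C i j with i ∈? C
  ... | yes _ = i , j
  ... | no _ = j , i

  code : List (Fin n) → V⁺ → Fin n × Fin n
  code C (inj₁ v) = v , v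
  code C (inj₂ ((i , j) , _)) = orient C i j

  orient-cases : ∀ C i j → orient C i j ≡ (i , j) ⊎ orient C i j ≡ (j , i)
  orient-cases C i j with i ∈? C
  ... | yes _ = inj₁ refl
  ... | no _ = inj₂ refl

  orient-≢-diagonal : ∀ C {i j v} → i Fin.< j → orient C i j ≢ (v , v)
  orient-≢-diagonal C {i} i<j eq with i ∈? C | eq
  ... | yes _ | refl = Fin.<-irrefl refl i<j
  ... | no _ | refl = Fin.<-irrefl refl i<j

  code-injective : ∀ C {x y} → code C x ≡ code C y → x ≡ y
  code-injective C {inj₁ v} {inj₁ .v} refl = refl
  code-injective C {inj₁ v} {inj₂ (_ , i<j , _)} eq = ⊥-elim (orient-≢-diagonal C i<j (sym eq))
  code-injective C {inj₂ (_ , i<j , _)} {inj₁ v} eq = ⊥-elim (orient-≢-diagonal C i<j eq)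
  code-injective C {inj₂ ((i , j) , i<j , a)} {inj₂ ((i′ , j′) , i′<j′ , a′)} eq
    with orientation-unique i<j i′<j′ (orient-cases C i j)
           (Data.Sum.map (trans eq) (trans eq) (orient-cases C i′ j′))
  ... | refl , refl =
    cong₂ (λ i<j a → inj₂ ((i , j) , i<j , a)) (Fin.<-irrelevant i<j i′<j′) (T-irrelevant a a′)

  code-∈ : ∀ {u x} → Touches u x →
           code (component u) x ∈ cartesianProduct (component u) (component u ++ S)
  code-∈ {x = inj₁ v} r = ∈-cartesianProduct⁺ (∈-component⁺ r) (∈-++⁺ˡ (∈-component⁺ r))
  code-∈ {u} {inj₂ ((i , j) , _ , a)} t with i ∈? component u | t
  ... | yes i∈C | _ = ∈-cartesianProduct⁺ i∈C (neighbour-∈-component-or-S i∈C a)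
  ... | no i∉C | inj₁ r = ⊥-elim (i∉C (∈-component⁺ r))
  ... | no _ | inj₂ r =
    ∈-cartesianProduct⁺ (∈-component⁺ r) (neighbour-∈-component-or-S (∈-component⁺ r) (adj-sym a))

  length-component⁺≤ : ∀ {u C⁺} → IsComponent G⁺ S⁺ C⁺ → inj₁ u ∈ C⁺ →
                     length C⁺ ≤ length (component u) * (length (component u) + length S)
  length-component⁺≤ {u} {C⁺} isC u∈C⁺ = begin
    length C⁺                             ≡⟨ sym (length-map (code C) C⁺) ⟩
    length (map (code C) C⁺)              ≤⟨ Unique-⊆⇒length≤ (Unique.map⁺ (code-injective C) uniq) code⊆ ⟩
    length (cartesianProduct C (C ++ S))  ≡⟨ length-cartesianProduct C (C ++ S) ⟩
    length C * length (C ++ S)            ≡⟨ cong (length C *_) (length-++ C) ⟩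
    length C * (length C + length S)      ∎
    where
    open ≤-Reasoning
    open IsComponent isC
    C = component u
    code⊆ : map (code C) C⁺ ⊆ cartesianProduct C (C ++ S)
    code⊆ p with ∈-map⁻ (code C) p
    ... | x , x∈C⁺ , refl =
      code-∈ (Reach⁺⇒Touches (connected u∈C⁺ x∈C⁺) (here (∉S⁺⇒∉S (avoids u∈C⁺))))

  triangle-vertex-isolated : ∀ {i j} {i<j : i Fin.< j} {a : T (adj G i j)} → i ∈ S → j ∈ S → ∀ {y} →
                             Reach G⁺ S⁺ (inj₂ ((i , j) , i<j , a)) y → y ≡ inj₂ ((i , j) , i<j , a)
  triangle-vertex-isolated i∈S j∈S (here _) = refl
  triangle-vertex-isolated i∈S j∈S (step {w = inj₁ _} _ (inj₁ refl) r) =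
    ⊥-elim (Reach⇒source∉ G⁺ r (∈-map⁺ inj₁ i∈S))
  triangle-vertex-isolated i∈S j∈S (step {w = inj₁ _} _ (inj₂ refl) r) =
    ⊥-elim (Reach⇒source∉ G⁺ r (∈-map⁺ inj₁ j∈S))
  triangle-vertex-isolated i∈S j∈S (step {w = inj₂ _} _ () r)

  CompBound⇒length-component⁺≤ : ∀ {m} → CompBound (asGraph G) S m →
                                 ∀ {u C⁺} → IsComponent G⁺ S⁺ C⁺ → inj₁ u ∈ C⁺ →
                                 length C⁺ ≤ m * (m + length S)
  CompBound⇒length-component⁺≤ bound {u} isC u∈C⁺ =
    ≤-trans (length-component⁺≤ isC u∈C⁺) (*-mono-≤ C≤m (+-monoˡ-≤ (length S) C≤m))
    where
    C≤m = bound (component u) (component-isComponent (∉S⁺⇒∉S (IsComponent.avoids isC u∈C⁺)))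

  length-isolated-component⁺≤ : ∀ {i j} {i<j : i Fin.< j} {a : T (adj G i j)} {C⁺} →
                                IsComponent G⁺ S⁺ C⁺ → inj₂ ((i , j) , i<j , a) ∈ C⁺ → i ∈ S → j ∈ S →
                                length C⁺ ≤ length S ∸ 1
  length-isolated-component⁺≤ {i<j = i<j} {C⁺ = C⁺} isC e∈C⁺ i∈S j∈S = begin
    length C⁺     ≤⟨ Unique-constant⇒length≤1 uniq C⁺-trivial ⟩
    1             ≤⟨ ∸-monoˡ-≤ 1 (distinct-∈⇒2≤length (λ i≡j → Fin.<-irrefl i≡j i<j) i∈S j∈S) ⟩
    length S ∸ 1  ∎
    where
    open ≤-Reasoning
    open IsComponent isC
    C⁺-trivial = λ {y} y∈C⁺ → triangle-vertex-isolated i∈S j∈S {y} (connected e∈C⁺ y∈C⁺)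

  length-component⁺≤-cases : ∀ {m} → CompBound (asGraph G) S m → ∀ {C⁺} → IsComponent G⁺ S⁺ C⁺ →
                           length C⁺ ≤ m * (m + length S) ⊎ length C⁺ ≤ length S ∸ 1
  length-component⁺≤-cases bound isC with IsComponent.nonempty isC
  ... | inj₁ _ , u∈C⁺ = inj₁ (CompBound⇒length-component⁺≤ bound isC u∈C⁺)
  ... | inj₂ ((i , j) , _) , e∈C⁺ with i ∈? S | j ∈? S
  ...   | no i∉S | _ =
    inj₁ (CompBound⇒length-component⁺≤ bound isC (closed e∈C⁺ (∉S⇒∉S⁺ i∉S) (inj₁ refl)))
    where open IsComponent isC
  ...   | yes _ | no j∉S =
    inj₁ (CompBound⇒length-component⁺≤ bound isC (closed e∈C⁺ (∉S⇒∉S⁺ j∉S) (inj₂ refl)))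
    where open IsComponent isC
  ...   | yes i∈S | yes j∈S = inj₂ (length-isolated-component⁺≤ isC e∈C⁺ i∈S j∈S)

  CompBound-withTriangles : ∀ {m} → CompBound (asGraph G) S m →
                            CompBound G⁺ S⁺ (m * (m + length S) + (length S ∸ 1))
  CompBound-withTriangles bound _ isC =
    [ (λ ≤l → ≤-trans ≤l (m≤m+n _ _)) , (λ ≤r → ≤-trans ≤r (m≤n+m _ _)) ]′
      (length-component⁺≤-cases bound isC)

mainTheorem9 : ∀ {n} (G : SimpleGraph n) (k k' : ℕ) → IsVI (asGraph G) k → IsVI (withTriangles G) k' → k' ≤ k * k
mainTheorem9 G k k' ((S , m , S-unique , S-bound , refl) , _) (_ , vi⁺-minimal) =
  decidable-stable (k' ≤? k * k) λ k'≰k*k → ¬¬-Reach-decidable G S λ reach? → k'≰k*k (k'≤k*k reach?)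
  where
  s = length S
  k'≤k*k : Decidable (Reach (asGraph G) S) → k' ≤ (s + m) * (s + m)
  k'≤k*k reach? = begin
    k'                                       ≤⟨ vi⁺-minimal S⁺ _ S⁺-unique (CompBound-withTriangles S-bound) ⟩
    length S⁺ + (m * (m + s) + (s ∸ 1))      ≡⟨ cong (_+ (m * (m + s) + (s ∸ 1))) (length-map inj₁ S) ⟩
    s + (m * (m + s) + (s ∸ 1))              ≤⟨ separator-bound s m ⟩
    (s + m) * (s + m)                        ∎
    where
    open ≤-Reasoning
    open WithTriangles G S reach?
    S⁺-unique = Unique.map⁺ (λ { refl → refl }) S-unique
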